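{- Let $G$ be a free metabelian group of finite rank $n\geq 2$ and let $G'=[G,G]$. If $d\in G'$ is such that for every $v\in G\setminus G'$ there exists $c\in G'$ with $d=[c,v]$, then $d=1$.
   Context: A free metabelian group of rank $n$ is $F_n/F_n''$ with $F_n$ free of rank $n$. Commutators are $[x,y]=x^{ -1}y^{ -1}xy$. -}

module Defs where

open import Data.Nat using (ℕ)
open import Data.Fin using (Fin)
open import Data.Bool using (Bool; not)
open import Data.List using (List; []; _∷_; _++_; reverse; map; foldr)
open import Data.Product using (Σ; _×_; _,_; proj₁; proj₂)

-- A letter: generator index together with an exponent flag
-- (false = x_i, true = x_i⁻¹).
Letter : ℕ → Set
Letter n = Fin n × Bool

Word : ℕ → Set
Word n = List (Letter n)

flipL : ∀ {n} → Letter n → Letter n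
flipL (i , b) = (i , not b)

inv : ∀ {n} → Word n → Word n
inv w = reverse (map flipL w)

comm : ∀ {n} → Word n → Word n → Word n
comm x y = inv x ++ inv y ++ x ++ y

-- Equality in the free metabelian group F_n / F_n'':
-- the congruence on words generated by free cancellation a a⁻¹ = 1 and the
-- relations [[a,b],[c,d]] = 1 (these generate F_n'' as a normal subgroup).
infix 4 _≈_
data _≈_ {n : ℕ} : Word n → Word n → Set where
  ≈-refl  : ∀ {u} → u ≈ u
  ≈-sym   : ∀ {u v} → u ≈ v → v ≈ u
  ≈-trans : ∀ {u v w} → u ≈ v → v ≈ w → u ≈ w
  cancel  : ∀ u v a → (u ++ a ∷ flipL a ∷ v) ≈ (u ++ v)
  metab   : ∀ u v a b c d → (u ++ comm (comm a b) (comm c d) ++ v) ≈ (u ++ v)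

commProd : ∀ {n} → List (Word n × Word n) → Word n
commProd ps = foldr (λ p acc → comm (proj₁ p) (proj₂ p) ++ acc) [] ps

InDerived : ∀ {n} → Word n → Set
InDerived {n} w = Σ (List (Word n × Word n)) λ ps → w ≈ commProd ps

{-# OPTIONS --safe #-}

-- A word traces a walk in the lattice ℤⁿ, and its image in F/F″ is governed by the endpoint of the walk
-- and by its flow, the net number of times each lattice edge is crossed (the Magnus embedding in
-- combinatorial form).  Words of G′ are closed walks, and a closed walk with zero flow is trivial: it
-- telescopes into a product of conjugated edge commutators, which commute because G′ is abelian and
-- therefore cancel in pairs.
--
-- Take v = x₀ᴺ with N > 2|d|.  If d = [c, v] with c ∈ G′, the flow of d is g(· + N e₀) − g for the
-- finitely supported flow g of c, and it vanishes off the slab |first coordinate| ≤ |d|.  As N exceeds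
-- the width of that slab, g is N-periodic along e₀ off the slab and hence zero; so d has zero flow.

module Submission where

open import Defs
open import Data.Bool using (Bool; true; false; not)
import Data.Bool.Properties as Bool
open import Data.Fin using (Fin; zero; suc)
import Data.Fin.Properties as Fin
open import Data.Integer using (ℤ; +_; -[1+_]; _+_; _-_; -_; _*_; 0ℤ; 1ℤ; -1ℤ; ∣_∣; _≤_; _<_; +≤+; +<+; -<+; -<-)
import Data.Integer.Properties as ℤ
open import Algebra.Properties.CommutativeSemigroup ℤ.+-commutativeSemigroup using (xy∙z≈xz∙y; x∙yz≈y∙xz)
open import Data.Integer.Tactic.RingSolver using (solve-∀)
open import Data.List using (List; []; _∷_; _++_; [_]; reverse; map; replicate; concatMap; length)
open import Data.List.Properties using (++-assoc; ++-identityʳ; reverse-++; map-++; concatMap-++; length-++-sucʳ; ++-monoid)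
open import Data.List.Membership.Propositional using (_∈_; _∉_)
open import Data.List.Membership.Propositional.Properties using (∈-∃++)
open import Data.List.Relation.Unary.All as All using (All; []; _∷_)
open import Data.List.Relation.Unary.Any using (here; there; any?)
open import Data.Nat as ℕ using (ℕ; zero; suc; _≥_)
import Data.Nat.Properties as ℕ
open import Data.Product using (Σ; ∃; ∃₂; _×_; _,_; proj₁; proj₂)
open import Data.Product.Properties using (≡-dec)
open import Data.Vec as Vec using (Vec; []; _∷_; head)
import Data.Vec.Properties as Vecₚ
open import Function using (_∘_)
open import Level using (0ℓ)
open import Relation.Binary.Bundles using (Setoid)
open import Relation.Binary.Definitions using (DecidableEquality)
open import Relation.Binary.PropositionalEquality using (_≡_; _≢_; refl; sym; trans; cong; cong₂; subst; subst₂; module ≡-Reasoning)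
import Relation.Binary.Reasoning.Setoid as SetoidReasoning
open import Relation.Nullary using (Dec; yes; no; ¬_)
open import Relation.Nullary.Negation using (contradiction)
open import Tactic.MonoidSolver using (solve)

private
  variable
    m n : ℕ

-- Words modulo the metabelian relations

module _ {n : ℕ} where

  flipL-involutive : (a : Letter n) → flipL (flipL a) ≡ a
  flipL-involutive (i , b) = cong (i ,_) (Bool.not-involutive b)

  inv-++ : (u v : Word n) → inv (u ++ v) ≡ inv v ++ inv u
  inv-++ u v = trans (cong reverse (map-++ flipL u v)) (reverse-++ (map flipL u) (map flipL v))

  inv-involutive : (w : Word n) → inv (inv w) ≡ w
  inv-involutive [] = refl
  inv-involutive (a ∷ w) = begin
    inv (inv ([ a ] ++ w))            ≡⟨ cong inv (inv-++ [ a ] w) ⟩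
    inv (inv w ++ [ flipL a ])        ≡⟨ inv-++ (inv w) [ flipL a ] ⟩
    flipL (flipL a) ∷ inv (inv w)     ≡⟨ cong₂ _∷_ (flipL-involutive a) (inv-involutive w) ⟩
    a ∷ w                             ∎
    where open ≡-Reasoning

  inv-comm : (x y : Word n) → inv (comm x y) ≡ comm y x
  inv-comm x y = begin
    inv (inv x ++ inv y ++ x ++ y)
      ≡⟨ inv-++ (inv x) _ ⟩
    inv (inv y ++ x ++ y) ++ inv (inv x)
      ≡⟨ cong (_++ inv (inv x)) (inv-++ (inv y) _) ⟩
    (inv (x ++ y) ++ inv (inv y)) ++ inv (inv x)
      ≡⟨ cong (λ z → (z ++ inv (inv y)) ++ inv (inv x)) (inv-++ x y) ⟩
    ((inv y ++ inv x) ++ inv (inv y)) ++ inv (inv x)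
      ≡⟨ cong₂ (λ p q → ((inv y ++ inv x) ++ p) ++ q) (inv-involutive y) (inv-involutive x) ⟩
    ((inv y ++ inv x) ++ y) ++ x
      ≡⟨ solve (++-monoid (Letter n)) ⟩
    comm y x
      ∎
    where open ≡-Reasoning

  ≈-setoid : Setoid 0ℓ 0ℓ
  ≈-setoid = record
    { Carrier = Word n ; _≈_ = _≈_
    ; isEquivalence = record { refl = ≈-refl ; sym = ≈-sym ; trans = ≈-trans } }

  ≡⇒≈ : {u v : Word n} → u ≡ v → u ≈ v
  ≡⇒≈ refl = ≈-refl

  private
    reassoc : (x u m v y : Word n) → (x ++ u) ++ m ++ v ++ y ≡ x ++ (u ++ m ++ v) ++ y
    reassoc _ _ _ _ _ = solve (++-monoid (Letter n))

  ++-cong-inner : (x y : Word n) {u v : Word n} → u ≈ v → (x ++ u ++ y) ≈ (x ++ v ++ y)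
  ++-cong-inner x y ≈-refl = ≈-refl
  ++-cong-inner x y (≈-sym p) = ≈-sym (++-cong-inner x y p)
  ++-cong-inner x y (≈-trans p q) = ≈-trans (++-cong-inner x y p) (++-cong-inner x y q)
  ++-cong-inner x y (cancel u v a) =
    subst₂ _≈_ (reassoc x u (a ∷ flipL a ∷ []) v y) (reassoc x u [] v y) (cancel (x ++ u) (v ++ y) a)
  ++-cong-inner x y (metab u v a b c d) =
    subst₂ _≈_ (reassoc x u (comm (comm a b) (comm c d)) v y) (reassoc x u [] v y)
      (metab (x ++ u) (v ++ y) a b c d)

  module ≈-Reasoning = SetoidReasoning ≈-setoid

  ++-congˡ : (x : Word n) {u v : Word n} → u ≈ v → (x ++ u) ≈ (x ++ v)
  ++-congˡ x {u} {v} p = subst₂ _≈_ (cong (x ++_) (++-identityʳ u)) (cong (x ++_) (++-identityʳ v)) (++-cong-inner x [] p)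

  ++-congʳ : (y : Word n) {u v : Word n} → u ≈ v → (u ++ y) ≈ (v ++ y)
  ++-congʳ = ++-cong-inner []

  ++-cong : {u u′ v v′ : Word n} → u ≈ u′ → v ≈ v′ → (u ++ v) ≈ (u′ ++ v′)
  ++-cong {u′ = u′} {v = v} p q = ≈-trans (++-congʳ v p) (++-congˡ u′ q)

  private
    inv-++₃ : (u m v : Word n) → inv (u ++ m ++ v) ≡ inv v ++ inv m ++ inv u
    inv-++₃ u m v = trans (inv-++ u (m ++ v)) (trans (cong (_++ inv u) (inv-++ m v)) (++-assoc (inv v) (inv m) (inv u)))

  inv-cong : {u v : Word n} → u ≈ v → inv u ≈ inv v
  inv-cong ≈-refl = ≈-refl
  inv-cong (≈-sym p) = ≈-sym (inv-cong p)
  inv-cong (≈-trans p q) = ≈-trans (inv-cong p) (inv-cong q)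
  inv-cong (cancel u v a) = subst₂ _≈_ (sym lhs) (sym (inv-++ u v)) (cancel (inv v) (inv u) a)
    where
    lhs : inv (u ++ a ∷ flipL a ∷ v) ≡ inv v ++ a ∷ flipL a ∷ inv u
    lhs = trans (inv-++₃ u (a ∷ flipL a ∷ []) v) (cong (λ z → inv v ++ z ∷ flipL a ∷ inv u) (flipL-involutive a))
  inv-cong (metab u v a b c d) = subst₂ _≈_ (sym lhs) (sym (inv-++ u v)) (metab (inv v) (inv u) c d a b)
    where
    lhs : inv (u ++ comm (comm a b) (comm c d) ++ v) ≡ inv v ++ comm (comm c d) (comm a b) ++ inv u
    lhs = trans (inv-++₃ u (comm (comm a b) (comm c d)) v) (cong (λ z → inv v ++ z ++ inv u) (inv-comm (comm a b) (comm c d)))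

  inverseʳ : (w : Word n) → (w ++ inv w) ≈ []
  inverseʳ [] = ≈-refl
  inverseʳ (a ∷ w) = begin
    (a ∷ w) ++ inv ([ a ] ++ w)             ≡⟨ cong ((a ∷ w) ++_) (inv-++ [ a ] w) ⟩
    a ∷ w ++ inv w ++ [ flipL a ]           ≡⟨ cong (a ∷_) (++-assoc w (inv w) _) ⟨
    [ a ] ++ (w ++ inv w) ++ [ flipL a ]    ≈⟨ ++-cong-inner [ a ] [ flipL a ] (inverseʳ w) ⟩
    a ∷ flipL a ∷ []                        ≈⟨ cancel [] [] a ⟩
    []                                      ∎
    where open ≈-Reasoning

  inverseˡ : (w : Word n) → (inv w ++ w) ≈ []
  inverseˡ w = subst (λ z → (inv w ++ z) ≈ []) (inv-involutive w) (inverseʳ (inv w))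

  cancelʳ : (w y : Word n) → (w ++ inv w ++ y) ≈ y
  cancelʳ w y = ≈-trans (≡⇒≈ (sym (++-assoc w (inv w) y))) (++-congʳ y (inverseʳ w))

  cancelˡ : (w y : Word n) → (inv w ++ w ++ y) ≈ y
  cancelˡ w y = ≈-trans (≡⇒≈ (sym (++-assoc (inv w) w y))) (++-congʳ y (inverseˡ w))

  comm≈[]⇒commute : (x y : Word n) → comm y x ≈ [] → (x ++ y) ≈ (y ++ x)
  comm≈[]⇒commute x y h = begin
    x ++ y                                   ≡⟨ ++-identityʳ _ ⟨
    (x ++ y) ++ []                           ≈⟨ ++-congˡ (x ++ y) h ⟨
    (x ++ y) ++ inv y ++ inv x ++ y ++ x     ≡⟨ solve (++-monoid (Letter n)) ⟩
    x ++ (y ++ inv y) ++ inv x ++ y ++ x     ≈⟨ ++-cong-inner x _ (inverseʳ y) ⟩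
    x ++ inv x ++ y ++ x                     ≡⟨ solve (++-monoid (Letter n)) ⟩
    [] ++ (x ++ inv x) ++ y ++ x             ≈⟨ ++-cong-inner [] _ (inverseʳ x) ⟩
    y ++ x                                   ∎
    where open ≈-Reasoning

  IsCommutator : Word n → Set
  IsCommutator u = ∃₂ λ a b → u ≈ comm a b

  commutators-commute : {u v : Word n} → IsCommutator u → IsCommutator v → (u ++ v) ≈ (v ++ u)
  commutators-commute (a , b , p) (c , d , q) =
    ≈-trans (++-cong p q) (≈-trans (comm≈[]⇒commute (comm a b) (comm c d) metabelian) (≈-sym (++-cong q p)))
    where
    metabelian : comm (comm c d) (comm a b) ≈ []
    metabelian = subst (_≈ []) (++-identityʳ _) (metab [] [] c d a b)

  IsCommutator-resp : {u v : Word n} → u ≈ v → IsCommutator v → IsCommutator u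
  IsCommutator-resp p (a , b , q) = a , b , ≈-trans p q

  IsCommutator-inv : {u : Word n} → IsCommutator u → IsCommutator (inv u)
  IsCommutator-inv (a , b , p) = b , a , ≈-trans (inv-cong p) (≡⇒≈ (inv-comm a b))

  conj : Word n → Word n → Word n
  conj g u = g ++ u ++ inv g

  inv-conj : (g u : Word n) → inv (conj g u) ≡ conj g (inv u)
  inv-conj g u = trans (inv-++₃ g u (inv g)) (cong (λ z → z ++ inv u ++ inv g) (inv-involutive g))

  conj-comm : (g a b : Word n) → comm (conj g a) (conj g b) ≈ conj g (comm a b)
  conj-comm g a b = begin
    comm (conj g a) (conj g b)
      ≡⟨ cong₂ (λ p q → p ++ q ++ conj g a ++ conj g b) (inv-conj g a) (inv-conj g b) ⟩
    conj g (inv a) ++ conj g (inv b) ++ conj g a ++ conj g b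
      ≡⟨ solve (++-monoid (Letter n)) ⟩
    (g ++ inv a) ++ (inv g ++ g) ++ inv b ++ inv g ++ g ++ a ++ inv g ++ g ++ b ++ inv g
      ≈⟨ ++-cong-inner (g ++ inv a) _ (inverseˡ g) ⟩
    (g ++ inv a) ++ inv b ++ inv g ++ g ++ a ++ inv g ++ g ++ b ++ inv g
      ≡⟨ solve (++-monoid (Letter n)) ⟩
    (g ++ inv a ++ inv b) ++ (inv g ++ g) ++ a ++ inv g ++ g ++ b ++ inv g
      ≈⟨ ++-cong-inner (g ++ inv a ++ inv b) _ (inverseˡ g) ⟩
    (g ++ inv a ++ inv b) ++ a ++ inv g ++ g ++ b ++ inv g
      ≡⟨ solve (++-monoid (Letter n)) ⟩
    (g ++ inv a ++ inv b ++ a) ++ (inv g ++ g) ++ b ++ inv g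
      ≈⟨ ++-cong-inner (g ++ inv a ++ inv b ++ a) _ (inverseˡ g) ⟩
    (g ++ inv a ++ inv b ++ a) ++ b ++ inv g
      ≡⟨ solve (++-monoid (Letter n)) ⟩
    conj g (comm a b)
      ∎
    where open ≈-Reasoning

  IsCommutator-conj : (g : Word n) {u : Word n} → IsCommutator u → IsCommutator (conj g u)
  IsCommutator-conj g (a , b , p) = conj g a , conj g b , ≈-trans (++-cong-inner g (inv g) p) (≈-sym (conj-comm g a b))


-- Walks in the lattice ℤⁿ

Point : ℕ → Set
Point n = Vec ℤ n

translate : Fin n → ℤ → Point n → Point n
translate zero    t (z ∷ p) = z + t ∷ p
translate (suc i) t (z ∷ p) = z ∷ translate i t p

translate-comm : ∀ (i j : Fin n) s t (q : Point n) → translate i s (translate j t q) ≡ translate j t (translate i s q)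
translate-comm zero    zero    s t (z ∷ q) = cong (_∷ q) (xy∙z≈xz∙y z t s)
translate-comm zero    (suc j) s t (z ∷ q) = refl
translate-comm (suc i) zero    s t (z ∷ q) = refl
translate-comm (suc i) (suc j) s t (z ∷ q) = cong (z ∷_) (translate-comm i j s t q)

translate-translate : ∀ (i : Fin n) s t (q : Point n) → translate i s (translate i t q) ≡ translate i (t + s) q
translate-translate zero    s t (z ∷ q) = cong (_∷ q) (ℤ.+-assoc z t s)
translate-translate (suc i) s t (z ∷ q) = cong (z ∷_) (translate-translate i s t q)

translate-0 : ∀ (i : Fin n) (q : Point n) → translate i 0ℤ q ≡ q
translate-0 zero    (z ∷ q) = cong (_∷ q) (ℤ.+-identityʳ z)
translate-0 (suc i) (z ∷ q) = cong (z ∷_) (translate-0 i q)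

translate-inverse : ∀ (i : Fin n) s t (q : Point n) → t + s ≡ 0ℤ → translate i s (translate i t q) ≡ q
translate-inverse i s t q t+s≡0 = trans (translate-translate i s t q) (trans (cong (λ u → translate i u q) t+s≡0) (translate-0 i q))

translate-injective : ∀ (i : Fin n) t {p q : Point n} → translate i t p ≡ translate i t q → p ≡ q
translate-injective i t {p} {q} eq = begin
  p                                    ≡⟨ translate-inverse i (- t) t p (ℤ.+-inverseʳ t) ⟨
  translate i (- t) (translate i t p)  ≡⟨ cong (translate i (- t)) eq ⟩
  translate i (- t) (translate i t q)  ≡⟨ translate-inverse i (- t) t q (ℤ.+-inverseʳ t) ⟩
  q                                    ∎
  where open ≡-Reasoning

origin : Point n
origin = Vec.replicate _ 0ℤ

sgn : Bool → ℤ
sgn false = 1ℤ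
sgn true  = -1ℤ

sgn-not : ∀ b → sgn b + sgn (not b) ≡ 0ℤ
sgn-not false = refl
sgn-not true  = refl

module _ {n : ℕ} where

  step : Letter n → Point n → Point n
  step (i , b) = translate i (sgn b)

  step-comm : ∀ x y q → step x (step y q) ≡ step y (step x q)
  step-comm (i , b) (j , c) = translate-comm i j (sgn b) (sgn c)

  step-flipL : ∀ x q → step (flipL x) (step x q) ≡ q
  step-flipL (i , b) q = translate-inverse i (sgn (not b)) (sgn b) q (sgn-not b)

  endpoint : Point n → Word n → Point n
  endpoint q []      = q
  endpoint q (x ∷ w) = endpoint (step x q) w

  endpoint-++ : ∀ q u v → endpoint q (u ++ v) ≡ endpoint (endpoint q u) v
  endpoint-++ q []      v = refl
  endpoint-++ q (x ∷ u) v = endpoint-++ (step x q) u v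

  endpoint-step : ∀ x q w → endpoint (step x q) w ≡ step x (endpoint q w)
  endpoint-step x q []      = refl
  endpoint-step x q (y ∷ w) = trans (cong (λ r → endpoint r w) (step-comm y x q)) (endpoint-step x (step y q) w)

  endpoint-endpoint : ∀ q u v → endpoint (endpoint q u) v ≡ endpoint (endpoint q v) u
  endpoint-endpoint q []      v = refl
  endpoint-endpoint q (x ∷ u) v = trans (endpoint-endpoint (step x q) u v) (cong (λ r → endpoint r u) (endpoint-step x q v))

  endpoint-inv : ∀ q w → endpoint (endpoint q w) (inv w) ≡ q
  endpoint-inv q []      = refl
  endpoint-inv q (x ∷ w) = begin
    endpoint (endpoint (step x q) w) (inv ([ x ] ++ w))            ≡⟨ cong (endpoint _) (inv-++ [ x ] w) ⟩
    endpoint (endpoint (step x q) w) (inv w ++ [ flipL x ])        ≡⟨ endpoint-++ _ (inv w) [ flipL x ] ⟩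
    step (flipL x) (endpoint (endpoint (step x q) w) (inv w))      ≡⟨ cong (step (flipL x)) (endpoint-inv (step x q) w) ⟩
    step (flipL x) (step x q)                                      ≡⟨ step-flipL x q ⟩
    q                                                              ∎
    where open ≡-Reasoning

  endpoint-inv′ : ∀ q w → endpoint (endpoint q (inv w)) w ≡ q
  endpoint-inv′ q w = subst (λ z → endpoint (endpoint q (inv w)) z ≡ q) (inv-involutive w) (endpoint-inv q (inv w))

  Loop : Word n → Set
  Loop w = ∀ q → endpoint q w ≡ q

  Loop-inv : ∀ w → Loop w → Loop (inv w)
  Loop-inv w ℓ q = trans (cong (λ r → endpoint r (inv w)) (sym (ℓ q))) (endpoint-inv q w)

  Loop-++ : ∀ u v → Loop u → Loop v → Loop (u ++ v)
  Loop-++ u v ℓu ℓv q = trans (endpoint-++ q u v) (trans (ℓv _) (ℓu q))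

  Loop-comm : ∀ a b → Loop (comm a b)
  Loop-comm a b q = begin
    endpoint q (inv a ++ inv b ++ a ++ b)           ≡⟨ endpoint-++ q (inv a) _ ⟩
    endpoint q₁ (inv b ++ a ++ b)                   ≡⟨ endpoint-++ q₁ (inv b) _ ⟩
    endpoint (endpoint q₁ (inv b)) (a ++ b)         ≡⟨ endpoint-++ _ a b ⟩
    endpoint (endpoint (endpoint q₁ (inv b)) a) b   ≡⟨ cong (λ r → endpoint r b) (endpoint-endpoint q₁ (inv b) a) ⟩
    endpoint (endpoint (endpoint q₁ a) (inv b)) b   ≡⟨ cong (λ r → endpoint (endpoint r (inv b)) b) (endpoint-inv′ q a) ⟩
    endpoint (endpoint q (inv b)) b                 ≡⟨ endpoint-inv′ q b ⟩
    q                                               ∎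
    where
    open ≡-Reasoning
    q₁ = endpoint q (inv a)

  endpoint-cong : ∀ {u v} → u ≈ v → ∀ q → endpoint q u ≡ endpoint q v
  endpoint-cong ≈-refl        q = refl
  endpoint-cong (≈-sym p)     q = sym (endpoint-cong p q)
  endpoint-cong (≈-trans p r) q = trans (endpoint-cong p q) (endpoint-cong r q)
  endpoint-cong (cancel u v a) q =
    trans (endpoint-++ q u _) (trans (cong (λ r → endpoint r v) (step-flipL a (endpoint q u))) (sym (endpoint-++ q u v)))
  endpoint-cong (metab u v a b c d) q = begin
    endpoint q (u ++ R ++ v)                    ≡⟨ endpoint-++ q u _ ⟩
    endpoint (endpoint q u) (R ++ v)            ≡⟨ endpoint-++ _ R v ⟩
    endpoint (endpoint (endpoint q u) R) v      ≡⟨ cong (λ r → endpoint r v) (Loop-comm (comm a b) (comm c d) _) ⟩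
    endpoint (endpoint q u) v                   ≡⟨ endpoint-++ q u v ⟨
    endpoint q (u ++ v)                         ∎
    where
    R = comm (comm a b) (comm c d)
    open ≡-Reasoning

  Loop-commProd : ∀ ps → Loop (commProd {n} ps)
  Loop-commProd []             q = refl
  Loop-commProd ((a , b) ∷ ps) = Loop-++ (comm a b) (commProd ps) (Loop-comm a b) (Loop-commProd ps)

  derived⇒Loop : ∀ {w} → InDerived w → Loop w
  derived⇒Loop (ps , eq) q = trans (endpoint-cong eq q) (Loop-commProd ps q)

-- Edge flows

-- (p , i) is the lattice edge from p to p + eᵢ; the flag of a traversal is false when the edge is crossed
-- from p to p + eᵢ and true in the other direction, matching the exponent flag of a letter.
Edge : ℕ → Set
Edge n = Point n × Fin n

Traversal : ℕ → Set
Traversal n = Edge n × Bool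

_≟ᴱ_ : DecidableEquality (Edge n)
_≟ᴱ_ = ≡-dec (Vecₚ.≡-dec ℤ._≟_) Fin._≟_

_≟ᵀ_ : DecidableEquality (Traversal n)
_≟ᵀ_ = ≡-dec _≟ᴱ_ Bool._≟_

reverseT : Traversal n → Traversal n
reverseT (e , b) = e , not b

weight : Edge n → Traversal n → ℤ
weight e (k , b) with k ≟ᴱ e
... | yes _ = sgn b
... | no  _ = 0ℤ

flow : Edge n → List (Traversal n) → ℤ
flow e []      = 0ℤ
flow e (τ ∷ L) = weight e τ + flow e L

Balanced : List (Traversal n) → Set
Balanced L = ∀ e → flow e L ≡ 0ℤ

weight-reverseT : (e : Edge n) (τ : Traversal n) → weight e (reverseT τ) ≡ - weight e τ
weight-reverseT e (k , b) with k ≟ᴱ e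
weight-reverseT e (k , false) | yes _ = refl
weight-reverseT e (k , true)  | yes _ = refl
... | no _ = refl

weight-self : (k : Edge n) (b : Bool) → weight k (k , b) ≡ sgn b
weight-self k b with k ≟ᴱ k
... | yes _   = refl
... | no k≢k  = contradiction refl k≢k

flow-++ : (e : Edge n) (L M : List (Traversal n)) → flow e (L ++ M) ≡ flow e L + flow e M
flow-++ e []      M = sym (ℤ.+-identityˡ _)
flow-++ e (τ ∷ L) M = trans (cong (λ z → weight e τ + z) (flow-++ e L M)) (sym (ℤ.+-assoc (weight e τ) _ _))

flow-backtrack : (e : Edge n) (τ : Traversal n) (L : List (Traversal n)) → flow e (τ ∷ reverseT τ ∷ L) ≡ flow e L
flow-backtrack e τ L = begin
  weight e τ + (weight e (reverseT τ) + flow e L)   ≡⟨ cong (λ z → weight e τ + (z + flow e L)) (weight-reverseT e τ) ⟩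
  weight e τ + (- weight e τ + flow e L)            ≡⟨ ℤ.+-assoc (weight e τ) _ _ ⟨
  (weight e τ - weight e τ) + flow e L              ≡⟨ cong (_+ flow e L) (ℤ.+-inverseʳ (weight e τ)) ⟩
  0ℤ + flow e L                                     ≡⟨ ℤ.+-identityˡ _ ⟩
  flow e L                                          ∎
  where open ≡-Reasoning

flow-move : (e : Edge n) (X : List (Traversal n)) (σ : Traversal n) (Y : List (Traversal n)) →
            flow e (X ++ σ ∷ Y) ≡ flow e (σ ∷ X ++ Y)
flow-move e X σ Y = begin
  flow e (X ++ σ ∷ Y)                     ≡⟨ flow-++ e X (σ ∷ Y) ⟩
  flow e X + (weight e σ + flow e Y)      ≡⟨ x∙yz≈y∙xz (flow e X) (weight e σ) (flow e Y) ⟩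
  weight e σ + (flow e X + flow e Y)      ≡⟨ cong (λ z → weight e σ + z) (flow-++ e X Y) ⟨
  flow e (σ ∷ X ++ Y)                     ∎
  where open ≡-Reasoning

flow-avoiding : (e : Edge n) (L : List (Traversal n)) → All (λ τ → proj₁ τ ≢ e) L → flow e L ≡ 0ℤ
flow-avoiding e []            []          = refl
flow-avoiding e ((k , b) ∷ L) (k≢e ∷ avoid) with k ≟ᴱ e
... | yes k≡e = contradiction k≡e k≢e
... | no _    = trans (ℤ.+-identityˡ _) (flow-avoiding e L avoid)

sgn-+-* : ∀ b c → sgn b + sgn b * + c ≡ sgn b * + suc c
sgn-+-* b c = trans (cong (λ z → z + sgn b * + c) (sym (ℤ.*-identityʳ (sgn b)))) (sym (ℤ.*-distribˡ-+ (sgn b) 1ℤ (+ c)))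

sgn*suc≢0 : ∀ b c → sgn b * + suc c ≢ 0ℤ
sgn*suc≢0 false c ()
sgn*suc≢0 true  c ()

flow-without-reverse : (k : Edge n) (b : Bool) (L : List (Traversal n)) → (k , not b) ∉ L → ∃ λ c → flow k L ≡ sgn b * + c
flow-without-reverse k b []              _ = 0 , sym (ℤ.*-zeroʳ (sgn b))
flow-without-reverse k b ((k′ , b′) ∷ L) ∉ with k′ ≟ᴱ k | flow-without-reverse k b L (∉ ∘ there)
... | no _     | c , eq = c , trans (ℤ.+-identityˡ _) eq
... | yes refl | c , eq = suc c , trans (cong₂ _+_ (cong sgn b′≡b) eq) (sgn-+-* b c)
  where
  b′≡b : b′ ≡ b
  b′≡b = trans (Bool.¬-not (λ b′≡¬b → ∉ (here (cong (k ,_) (sym b′≡¬b))))) (Bool.not-involutive b)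

reverse-present : (k : Edge n) (b : Bool) (L : List (Traversal n)) → flow k ((k , b) ∷ L) ≡ 0ℤ → (k , not b) ∈ L
reverse-present k b L balanced with any? ((k , not b) ≟ᵀ_) L
... | yes ∈ = ∈
... | no ∉  =
  let c , eq = flow-without-reverse k b L ∉
  in  contradiction (trans (sym (sgn-+-* b c)) (trans (cong₂ _+_ (sym (weight-self k b)) (sym eq)) balanced)) (sgn*suc≢0 b c)

traversal : Letter n → Point n → Traversal n
traversal (i , false) q = (q , i) , false
traversal (i , true)  q = (translate i -1ℤ q , i) , true

traversals : Point n → Word n → List (Traversal n)
traversals q []      = []
traversals q (x ∷ w) = traversal x q ∷ traversals (step x q) w

walkFlow : Point n → Word n → Edge n → ℤ
walkFlow q w e = flow e (traversals q w)

traversal-flipL : (x : Letter n) (q : Point n) → traversal (flipL x) (step x q) ≡ reverseT (traversal x q)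
traversal-flipL (i , false) q = cong (λ p → (p , i) , true) (translate-inverse i -1ℤ 1ℤ q refl)
traversal-flipL (i , true)  q = refl

traversals-++ : (q : Point n) (u v : Word n) → traversals q (u ++ v) ≡ traversals q u ++ traversals (endpoint q u) v
traversals-++ q []      v = refl
traversals-++ q (x ∷ u) v = cong (traversal x q ∷_) (traversals-++ (step x q) u v)

walkFlow-++ : (q : Point n) (u v : Word n) (e : Edge n) → walkFlow q (u ++ v) e ≡ walkFlow q u e + walkFlow (endpoint q u) v e
walkFlow-++ q u v e = trans (cong (flow e) (traversals-++ q u v)) (flow-++ e (traversals q u) _)

walkFlow-retrace : (q : Point n) (w : Word n) (e : Edge n) → walkFlow (endpoint q w) (inv w) e ≡ - walkFlow q w e
walkFlow-retrace q []      e = refl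
walkFlow-retrace q (x ∷ w) e = begin
  walkFlow r (inv ([ x ] ++ w)) e
    ≡⟨ cong (λ z → walkFlow r z e) (inv-++ [ x ] w) ⟩
  walkFlow r (inv w ++ [ flipL x ]) e
    ≡⟨ walkFlow-++ r (inv w) _ e ⟩
  walkFlow r (inv w) e + walkFlow (endpoint r (inv w)) [ flipL x ] e
    ≡⟨ cong₂ _+_ (walkFlow-retrace q′ w e) (cong (λ p → walkFlow p [ flipL x ] e) (endpoint-inv q′ w)) ⟩
  - W + (weight e (traversal (flipL x) q′) + 0ℤ)
    ≡⟨ cong (λ σ → - W + (weight e σ + 0ℤ)) (traversal-flipL x q) ⟩
  - W + (weight e (reverseT τ) + 0ℤ)
    ≡⟨ cong (λ z → - W + z) (trans (ℤ.+-identityʳ _) (weight-reverseT e τ)) ⟩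
  - W + - weight e τ
    ≡⟨ ℤ.+-comm (- W) _ ⟩
  - weight e τ + - W
    ≡⟨ ℤ.neg-distrib-+ (weight e τ) W ⟨
  - (weight e τ + W)
    ∎
  where
  open ≡-Reasoning
  q′ = step x q
  r  = endpoint q′ w
  τ  = traversal x q
  W  = walkFlow q′ w e

walkFlow-inv : (q : Point n) (w : Word n) (e : Edge n) → walkFlow q (inv w) e ≡ - walkFlow (endpoint q (inv w)) w e
walkFlow-inv q w e = subst (λ p → walkFlow p (inv w) e ≡ - walkFlow (endpoint q (inv w)) w e) (endpoint-inv′ q w) (walkFlow-retrace _ w e)

private
  cancel-middle : ∀ C V C′ → - C + (- V + (C′ + V)) ≡ C′ - C
  cancel-middle = solve-∀

-- The two copies of v cancel in the flow, while c is traversed backwards from q and forwards from q v⁻¹.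
walkFlow-comm : (q : Point n) (c v : Word n) (e : Edge n) → Loop c →
                walkFlow q (comm c v) e ≡ walkFlow (endpoint q (inv v)) c e - walkFlow q c e
walkFlow-comm q c v e ℓ = begin
  walkFlow q (inv c ++ inv v ++ c ++ v) e
    ≡⟨ walkFlow-++ q (inv c) _ e ⟩
  walkFlow q (inv c) e + walkFlow (endpoint q (inv c)) (inv v ++ c ++ v) e
    ≡⟨ cong (λ p → walkFlow q (inv c) e + walkFlow p (inv v ++ c ++ v) e) (Loop-inv c ℓ q) ⟩
  walkFlow q (inv c) e + walkFlow q (inv v ++ c ++ v) e
    ≡⟨ cong (λ z → walkFlow q (inv c) e + z) (walkFlow-++ q (inv v) (c ++ v) e) ⟩
  walkFlow q (inv c) e + (walkFlow q (inv v) e + walkFlow q′ (c ++ v) e)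
    ≡⟨ cong (λ z → walkFlow q (inv c) e + (walkFlow q (inv v) e + z)) (walkFlow-++ q′ c v e) ⟩
  walkFlow q (inv c) e + (walkFlow q (inv v) e + (walkFlow q′ c e + walkFlow (endpoint q′ c) v e))
    ≡⟨ cong (λ p → walkFlow q (inv c) e + (walkFlow q (inv v) e + (walkFlow q′ c e + walkFlow p v e))) (ℓ q′) ⟩
  walkFlow q (inv c) e + (walkFlow q (inv v) e + (walkFlow q′ c e + walkFlow q′ v e))
    ≡⟨ cong₂ (λ a b → a + (b + (walkFlow q′ c e + walkFlow q′ v e))) backwards-c (walkFlow-inv q v e) ⟩
  - walkFlow q c e + (- walkFlow q′ v e + (walkFlow q′ c e + walkFlow q′ v e))
    ≡⟨ cancel-middle (walkFlow q c e) (walkFlow q′ v e) (walkFlow q′ c e) ⟩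
  walkFlow q′ c e - walkFlow q c e
    ∎
  where
  open ≡-Reasoning
  q′ = endpoint q (inv v)
  backwards-c : walkFlow q (inv c) e ≡ - walkFlow q c e
  backwards-c = trans (walkFlow-inv q c e) (cong (λ p → - walkFlow p c e) (Loop-inv c ℓ q))

walkFlow-comm-Loop : (q : Point n) (c v : Word n) (e : Edge n) → Loop c → Loop v → walkFlow q (comm c v) e ≡ 0ℤ
walkFlow-comm-Loop q c v e ℓc ℓv = begin
  walkFlow q (comm c v) e                          ≡⟨ walkFlow-comm q c v e ℓc ⟩
  walkFlow (endpoint q (inv v)) c e - walkFlow q c e  ≡⟨ cong (λ p → walkFlow p c e - walkFlow q c e) (Loop-inv v ℓv q) ⟩
  walkFlow q c e - walkFlow q c e                  ≡⟨ ℤ.+-inverseʳ (walkFlow q c e) ⟩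
  0ℤ                                               ∎
  where open ≡-Reasoning

walkFlow-insert : (q : Point n) (u m v : Word n) (e : Edge n) →
                  endpoint (endpoint q u) m ≡ endpoint q u → walkFlow (endpoint q u) m e ≡ 0ℤ →
                  walkFlow q (u ++ m ++ v) e ≡ walkFlow q (u ++ v) e
walkFlow-insert q u m v e closed flowless = begin
  walkFlow q (u ++ m ++ v) e                            ≡⟨ walkFlow-++ q u _ e ⟩
  U + walkFlow r (m ++ v) e                             ≡⟨ cong (λ z → U + z) (walkFlow-++ r m v e) ⟩
  U + (walkFlow r m e + walkFlow (endpoint r m) v e)    ≡⟨ cong₂ (λ a p → U + (a + walkFlow p v e)) flowless closed ⟩
  U + (0ℤ + walkFlow r v e)                             ≡⟨ cong (λ z → U + z) (ℤ.+-identityˡ _) ⟩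
  U + walkFlow r v e                                    ≡⟨ walkFlow-++ q u v e ⟨
  walkFlow q (u ++ v) e                                 ∎
  where
  open ≡-Reasoning
  r = endpoint q u
  U = walkFlow q u e

walkFlow-cong : {u v : Word n} → u ≈ v → ∀ q e → walkFlow q u e ≡ walkFlow q v e
walkFlow-cong ≈-refl         q e = refl
walkFlow-cong (≈-sym p)      q e = sym (walkFlow-cong p q e)
walkFlow-cong (≈-trans p p′) q e = trans (walkFlow-cong p q e) (walkFlow-cong p′ q e)
walkFlow-cong (cancel u v a) q e =
  walkFlow-insert q u (a ∷ flipL a ∷ []) v e (step-flipL a r)
    (trans (cong (λ τ → flow e (traversal a r ∷ τ ∷ [])) (traversal-flipL a r)) (flow-backtrack e (traversal a r) []))
  where r = endpoint q u
walkFlow-cong (metab u v a b c d) q e =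
  walkFlow-insert q u (comm (comm a b) (comm c d)) v e (Loop-comm (comm a b) (comm c d) _)
    (walkFlow-comm-Loop _ (comm a b) (comm c d) e (Loop-comm a b) (Loop-comm c d))

shiftEdge : Fin n → ℤ → Edge n → Edge n
shiftEdge i s (p , j) = translate i s p , j

shiftEdge-injective : (i : Fin n) (s : ℤ) {k e : Edge n} → shiftEdge i s k ≡ shiftEdge i s e → k ≡ e
shiftEdge-injective i s {p , j} {p′ , j′} eq = cong₂ _,_ (translate-injective i s (cong proj₁ eq)) (cong proj₂ eq)

weight-shift : (i : Fin n) (s : ℤ) (e k : Edge n) (b : Bool) → weight (shiftEdge i s e) (shiftEdge i s k , b) ≡ weight e (k , b)
weight-shift i s e k b with shiftEdge i s k ≟ᴱ shiftEdge i s e | k ≟ᴱ e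
... | yes _  | yes _  = refl
... | no _   | no _   = refl
... | yes eq | no k≢e = contradiction (shiftEdge-injective i s eq) k≢e
... | no ne  | yes eq = contradiction (cong (shiftEdge i s) eq) ne

walkFlow-translate : (i : Fin n) (s : ℤ) (q : Point n) (w : Word n) (e : Edge n) →
                     walkFlow (translate i s q) w (shiftEdge i s e) ≡ walkFlow q w e
walkFlow-translate i s q []            e = refl
walkFlow-translate i s q ((j , b) ∷ w) e =
  cong₂ _+_ (weight-translate b)
            (trans (cong (λ p → walkFlow p w (shiftEdge i s e)) (translate-comm j i (sgn b) s q))
                   (walkFlow-translate i s (step (j , b) q) w e))
  where
  weight-translate : ∀ b → weight (shiftEdge i s e) (traversal (j , b) (translate i s q)) ≡ weight e (traversal (j , b) q)
  weight-translate false = weight-shift i s e (q , j) false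
  weight-translate true  = trans (cong (λ p → weight (shiftEdge i s e) ((p , j) , true)) (translate-comm j i -1ℤ s q))
                                 (weight-shift i s e (translate j -1ℤ q , j) true)

height : Point (suc m) → ℕ
height q = ∣ head q ∣

height-translate : (i : Fin (suc m)) (s : ℤ) (q : Point (suc m)) → ∣ s ∣ ℕ.≤ 1 → height (translate i s q) ℕ.≤ suc (height q)
height-translate zero    s (z ∷ q) ∣s∣≤1 = begin
  ∣ z + s ∣        ≤⟨ ℤ.∣i+j∣≤∣i∣+∣j∣ z s ⟩
  ∣ z ∣ ℕ.+ ∣ s ∣  ≤⟨ ℕ.+-monoʳ-≤ ∣ z ∣ ∣s∣≤1 ⟩
  ∣ z ∣ ℕ.+ 1      ≡⟨ ℕ.+-comm ∣ z ∣ 1 ⟩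
  suc ∣ z ∣        ∎
  where open ℕ.≤-Reasoning
height-translate (suc i) s (z ∷ q) _     = ℕ.n≤1+n ∣ z ∣

∣sgn∣≤1 : ∀ b → ∣ sgn b ∣ ℕ.≤ 1
∣sgn∣≤1 false = ℕ.≤-refl
∣sgn∣≤1 true  = ℕ.≤-refl

height-step : (x : Letter (suc m)) (q : Point (suc m)) → height (step x q) ℕ.≤ suc (height q)
height-step (i , b) q = height-translate i (sgn b) q (∣sgn∣≤1 b)

height-traversal : (x : Letter (suc m)) (q : Point (suc m)) → height (proj₁ (proj₁ (traversal x q))) ℕ.≤ suc (height q)
height-traversal (i , false) q = ℕ.n≤1+n (height q)
height-traversal (i , true)  q = height-translate i -1ℤ q ℕ.≤-refl

traversals-height : (q : Point (suc m)) (w : Word (suc m)) →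
                    All (λ τ → height (proj₁ (proj₁ τ)) ℕ.≤ height q ℕ.+ length w) (traversals q w)
traversals-height q []      = []
traversals-height q (x ∷ w) =
  ℕ.≤-trans (height-traversal x q) (ℕ.≤-trans (ℕ.s≤s (ℕ.m≤m+n h ℓ)) suc-inward)
  ∷ All.map (λ near → ℕ.≤-trans near (ℕ.≤-trans (ℕ.+-monoˡ-≤ ℓ (height-step x q)) suc-inward))
            (traversals-height (step x q) w)
  where
  h = height q
  ℓ = length w
  suc-inward : suc h ℕ.+ ℓ ℕ.≤ h ℕ.+ suc ℓ
  suc-inward = ℕ.≤-reflexive (sym (ℕ.+-suc h ℓ))

walkFlow-supported : (q : Point (suc m)) (w : Word (suc m)) (p : Point (suc m)) (j : Fin (suc m)) →
                     height q ℕ.+ length w ℕ.< height p → walkFlow q w (p , j) ≡ 0ℤ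
walkFlow-supported {m} q w p j far = flow-avoiding (p , j) (traversals q w) (All.map (λ {τ} → avoids {τ}) (traversals-height q w))
  where
  avoids : ∀ {τ : Traversal (suc m)} → height (proj₁ (proj₁ τ)) ℕ.≤ height q ℕ.+ length w → proj₁ τ ≢ (p , j)
  avoids near eq = ℕ.<⇒≱ far (subst (λ e → height (proj₁ e) ℕ.≤ height q ℕ.+ length w) eq near)

-- Words with zero flow are trivial

replicate-snoc : ∀ {A : Set} k (a : A) → replicate (suc k) a ≡ replicate k a ++ [ a ]
replicate-snoc zero    a = refl
replicate-snoc (suc k) a = cong (a ∷_) (replicate-snoc k a)

power : Fin n → ℤ → Word n
power i (+ k)     = replicate k (i , false)
power i -[1+ k ]  = replicate (suc k) (i , true)

power-suc : (i : Fin n) (z : ℤ) → power i (z + 1ℤ) ≈ power i z ++ [ (i , false) ]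
power-suc i (+ k) = ≡⇒≈ (trans (cong (λ k′ → replicate k′ (i , false)) (ℕ.+-comm k 1)) (replicate-snoc k (i , false)))
power-suc i -[1+ zero ]  = ≈-sym (cancel [] [] (i , true))
power-suc i -[1+ suc k ] = begin
  replicate (suc k) (i , true)                                ≡⟨ ++-identityʳ _ ⟨
  replicate (suc k) (i , true) ++ []                          ≈⟨ cancel (replicate (suc k) (i , true)) [] (i , true) ⟨
  replicate (suc k) (i , true) ++ (i , true) ∷ [ (i , false) ] ≡⟨ ++-assoc (replicate (suc k) (i , true)) [ (i , true) ] _ ⟨
  (replicate (suc k) (i , true) ++ [ (i , true) ]) ++ [ (i , false) ] ≡⟨ cong (_++ [ (i , false) ]) (replicate-snoc (suc k) (i , true)) ⟨
  power i -[1+ suc k ] ++ [ (i , false) ]                     ∎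
  where open ≈-Reasoning

monomialVia : ∀ {k} → (Fin k → Fin n) → Vec ℤ k → Word n
monomialVia f []      = []
monomialVia f (z ∷ p) = power (f zero) z ++ monomialVia (f ∘ suc) p

-- Along the first letter the edge word is the conjugate of [C⁻¹, x⁻¹] by xᶻ; otherwise it is xᶻ E x⁻ᶻ for an
-- edge word E of the remaining letters.
edgeWordVia-isCommutator : ∀ {k} (f : Fin k → Fin n) (p : Vec ℤ k) (i : Fin k) →
  IsCommutator (monomialVia f p ++ (f i , false) ∷ inv (monomialVia f (translate i 1ℤ p)))
edgeWordVia-isCommutator {n} f (z ∷ p) zero =
  IsCommutator-resp reshape (IsCommutator-conj P inner)
  where
  P = power (f zero) z
  C = monomialVia (f ∘ suc) p
  x = (f zero , false)
  x̄ = (f zero , true)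
  P′ = power (f zero) (z + 1ℤ)
  inner : IsCommutator (C ++ x ∷ inv C ++ [ x̄ ])
  inner = inv C , [ x̄ ] , ≡⇒≈ (cong (λ w → w ++ x ∷ inv C ++ [ x̄ ]) (sym (inv-involutive C)))
  reshape : ((P ++ C) ++ x ∷ inv (P′ ++ C)) ≈ conj P (C ++ x ∷ inv C ++ [ x̄ ])
  reshape = begin
    (P ++ C) ++ x ∷ inv (P′ ++ C)                ≡⟨ cong (λ w → (P ++ C) ++ x ∷ w) (inv-++ P′ C) ⟩
    (P ++ C) ++ x ∷ inv C ++ inv P′              ≡⟨ ++-assoc (P ++ C) (x ∷ inv C) _ ⟨
    ((P ++ C) ++ x ∷ inv C) ++ inv P′            ≈⟨ ++-congˡ ((P ++ C) ++ x ∷ inv C) (inv-cong (power-suc (f zero) z)) ⟩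
    ((P ++ C) ++ x ∷ inv C) ++ inv (P ++ [ x ])  ≡⟨ cong (((P ++ C) ++ x ∷ inv C) ++_) (inv-++ P [ x ]) ⟩
    ((P ++ C) ++ x ∷ inv C) ++ [ x̄ ] ++ inv P                 ≡⟨ reassoc P C [ x ] (inv C) [ x̄ ] (inv P) ⟩
    P ++ (C ++ x ∷ inv C ++ [ x̄ ]) ++ inv P                   ∎
    where
    open ≈-Reasoning
    reassoc : (P C X D Y Q : Word n) → ((P ++ C) ++ X ++ D) ++ Y ++ Q ≡ P ++ (C ++ X ++ D ++ Y) ++ Q
    reassoc _ _ _ _ _ _ = solve (++-monoid (Letter n))
edgeWordVia-isCommutator {n} f (z ∷ p) (suc i) =
  IsCommutator-resp (≡⇒≈ reshape) (IsCommutator-conj P (edgeWordVia-isCommutator (f ∘ suc) p i))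
  where
  P = power (f zero) z
  C = monomialVia (f ∘ suc) p
  C′ = monomialVia (f ∘ suc) (translate i 1ℤ p)
  y = (f (suc i) , false)
  reshape : (P ++ C) ++ y ∷ inv (P ++ C′) ≡ conj P (C ++ y ∷ inv C′)
  reshape = trans (cong (λ w → (P ++ C) ++ y ∷ w) (inv-++ P C′)) (reassoc P C [ y ] (inv C′) (inv P))
    where
    reassoc : (P C X D Q : Word n) → (P ++ C) ++ X ++ D ++ Q ≡ P ++ (C ++ X ++ D) ++ Q
    reassoc _ _ _ _ _ = solve (++-monoid (Letter n))

monomial : Point n → Word n
monomial = monomialVia (λ i → i)

monomial-origin : ∀ {k} (f : Fin k → Fin n) → monomialVia f (Vec.replicate k 0ℤ) ≡ []
monomial-origin {k = zero}  f = refl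
monomial-origin {k = suc k} f = monomial-origin (f ∘ suc)

edgeWord : Edge n → Word n
edgeWord (p , i) = monomial p ++ (i , false) ∷ inv (monomial (translate i 1ℤ p))

traversalWord : Traversal n → Word n
traversalWord (e , false) = edgeWord e
traversalWord (e , true)  = inv (edgeWord e)

traversalProduct : List (Traversal n) → Word n
traversalProduct = concatMap traversalWord

traversalWord-isCommutator : (τ : Traversal n) → IsCommutator (traversalWord τ)
traversalWord-isCommutator ((p , i) , false) = edgeWordVia-isCommutator (λ j → j) p i
traversalWord-isCommutator ((p , i) , true)  = IsCommutator-inv (edgeWordVia-isCommutator (λ j → j) p i)

traversalWord-traversal : (x : Letter n) (q : Point n) → traversalWord (traversal x q) ≡ monomial q ++ x ∷ inv (monomial (step x q))
traversalWord-traversal (i , false) q = refl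
traversalWord-traversal (i , true)  q = begin
  inv (monomial q′ ++ (i , false) ∷ inv (monomial (translate i 1ℤ q′)))   ≡⟨ inv-++ (monomial q′) _ ⟩
  inv ([ (i , false) ] ++ inv (monomial (translate i 1ℤ q′))) ++ inv (monomial q′)
    ≡⟨ cong (_++ inv (monomial q′)) (inv-++ [ (i , false) ] (inv (monomial (translate i 1ℤ q′)))) ⟩
  (inv (inv (monomial (translate i 1ℤ q′))) ++ [ (i , true) ]) ++ inv (monomial q′)
    ≡⟨ cong (λ w → (inv (inv (monomial w)) ++ [ (i , true) ]) ++ inv (monomial q′)) (translate-inverse i 1ℤ -1ℤ q refl) ⟩
  (inv (inv (monomial q)) ++ [ (i , true) ]) ++ inv (monomial q′)
    ≡⟨ cong (λ w → (w ++ [ (i , true) ]) ++ inv (monomial q′)) (inv-involutive (monomial q)) ⟩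
  (monomial q ++ [ (i , true) ]) ++ inv (monomial q′)                     ≡⟨ ++-assoc (monomial q) _ _ ⟩
  monomial q ++ (i , true) ∷ inv (monomial q′)                             ∎
  where
  open ≡-Reasoning
  q′ = translate i -1ℤ q

-- Inserting monomial(q′)⁻¹ monomial(q′) after each letter telescopes w into a product of edge words.
telescope : (q : Point n) (w : Word n) → (monomial q ++ w) ≈ (traversalProduct (traversals q w) ++ monomial (endpoint q w))
telescope q []      = ≡⇒≈ (++-identityʳ (monomial q))
telescope {n} q (x ∷ w) = begin
  M ++ x ∷ w                                   ≡⟨ ++-assoc M [ x ] w ⟨
  (M ++ [ x ]) ++ w                            ≈⟨ ++-cong-inner (M ++ [ x ]) w (inverseˡ M′) ⟨
  (M ++ [ x ]) ++ (inv M′ ++ M′) ++ w          ≡⟨ reassoc M [ x ] (inv M′) M′ w ⟩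
  (M ++ x ∷ inv M′) ++ M′ ++ w                 ≡⟨ cong (_++ M′ ++ w) (traversalWord-traversal x q) ⟨
  traversalWord (traversal x q) ++ M′ ++ w     ≈⟨ ++-congˡ (traversalWord (traversal x q)) (telescope q′ w) ⟩
  traversalWord (traversal x q) ++ traversalProduct (traversals q′ w) ++ monomial (endpoint q′ w)
                                               ≡⟨ ++-assoc (traversalWord (traversal x q)) _ _ ⟨
  traversalProduct (traversals q (x ∷ w)) ++ monomial (endpoint q (x ∷ w)) ∎
  where
  open ≈-Reasoning
  q′ = step x q
  M  = monomial q
  M′ = monomial q′
  reassoc : (A X B C W : Word n) → (A ++ X) ++ (B ++ C) ++ W ≡ (A ++ X ++ B) ++ C ++ W
  reassoc _ _ _ _ _ = solve (++-monoid (Letter n))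

traversalProduct-commutes : (L : List (Traversal n)) {u : Word n} → IsCommutator u →
                                (traversalProduct L ++ u) ≈ (u ++ traversalProduct L)
traversalProduct-commutes []      {u} _  = ≡⇒≈ (sym (++-identityʳ u))
traversalProduct-commutes (τ ∷ L) {u} cu = begin
  (traversalWord τ ++ W) ++ u    ≡⟨ ++-assoc (traversalWord τ) W u ⟩
  traversalWord τ ++ W ++ u      ≈⟨ ++-congˡ (traversalWord τ) (traversalProduct-commutes L cu) ⟩
  traversalWord τ ++ u ++ W      ≡⟨ ++-assoc (traversalWord τ) u W ⟨
  (traversalWord τ ++ u) ++ W    ≈⟨ ++-congʳ W (commutators-commute (traversalWord-isCommutator τ) cu) ⟩
  (u ++ traversalWord τ) ++ W    ≡⟨ ++-assoc u (traversalWord τ) W ⟩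
  u ++ traversalWord τ ++ W      ∎
  where
  open ≈-Reasoning
  W = traversalProduct L

traversalWord-backtrack : (τ : Traversal n) (R : Word n) → (traversalWord τ ++ traversalWord (reverseT τ) ++ R) ≈ R
traversalWord-backtrack (e , false) R = cancelʳ (edgeWord e) R
traversalWord-backtrack (e , true)  R = cancelˡ (edgeWord e) R

-- A traversal and its reverse are found in L, moved together past commuting commutators, and cancelled.
balanced⇒trivial : (fuel : ℕ) (L : List (Traversal n)) → length L ℕ.≤ fuel → Balanced L → traversalProduct L ≈ []
balanced⇒trivial fuel       []              _           _        = ≈-refl
balanced⇒trivial (suc fuel) ((k , b) ∷ L′) (ℕ.s≤s len) balanced with ∈-∃++ (reverse-present k b L′ (balanced k))
... | X , Y , refl = begin
  traversalWord τ ++ traversalProduct (X ++ τ̄ ∷ Y)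
    ≡⟨ cong (traversalWord τ ++_) (concatMap-++ traversalWord X (τ̄ ∷ Y)) ⟩
  traversalWord τ ++ traversalProduct X ++ traversalWord τ̄ ++ W
    ≡⟨ cong (traversalWord τ ++_) (++-assoc (traversalProduct X) _ W) ⟨
  traversalWord τ ++ (traversalProduct X ++ traversalWord τ̄) ++ W
    ≈⟨ ++-cong-inner (traversalWord τ) W (traversalProduct-commutes X (traversalWord-isCommutator τ̄)) ⟩
  traversalWord τ ++ (traversalWord τ̄ ++ traversalProduct X) ++ W
    ≡⟨ cong (traversalWord τ ++_) (++-assoc (traversalWord τ̄) _ W) ⟩
  traversalWord τ ++ traversalWord τ̄ ++ traversalProduct X ++ W
    ≈⟨ traversalWord-backtrack τ (traversalProduct X ++ W) ⟩
  traversalProduct X ++ W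
    ≡⟨ concatMap-++ traversalWord X Y ⟨
  traversalProduct (X ++ Y)
    ≈⟨ balanced⇒trivial fuel (X ++ Y) shorter balanced′ ⟩
  []
    ∎
  where
  open ≈-Reasoning
  τ = (k , b)
  τ̄ = (k , not b)
  W = traversalProduct Y
  shorter : length (X ++ Y) ℕ.≤ fuel
  shorter = ℕ.<⇒≤ (subst (ℕ._≤ fuel) (length-++-sucʳ X τ̄ Y) len)
  balanced′ : Balanced (X ++ Y)
  balanced′ e = trans (sym (flow-backtrack e τ (X ++ Y)))
                      (trans (cong (λ z → weight e τ + z) (sym (flow-move e X τ̄ Y))) (balanced e))

flowless⇒trivial : (d : Word n) → endpoint origin d ≡ origin → (∀ e → walkFlow origin d e ≡ 0ℤ) → d ≈ []
flowless⇒trivial d closed flowless = begin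
  d                                  ≡⟨ cong (_++ d) (monomial-origin (λ i → i)) ⟨
  monomial origin ++ d               ≈⟨ telescope origin d ⟩
  D ++ monomial (endpoint origin d)  ≡⟨ cong (λ p → D ++ monomial p) closed ⟩
  D ++ monomial origin               ≡⟨ cong (D ++_) (monomial-origin (λ i → i)) ⟩
  D ++ []                            ≡⟨ ++-identityʳ D ⟩
  D                                  ≈⟨ balanced⇒trivial _ (traversals origin d) ℕ.≤-refl flowless ⟩
  []                                 ∎
  where
  open ≈-Reasoning
  D = traversalProduct (traversals origin d)

-- A difference equation on ℤ

Supported : ℕ → (ℤ → ℤ) → Set
Supported B f = ∀ z → B ℕ.< ∣ z ∣ → f z ≡ 0ℤ

above⇒<∣∣ : ∀ {B z} → + B < z → B ℕ.< ∣ z ∣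
above⇒<∣∣ (+<+ B<a) = B<a

below⇒<∣∣ : ∀ {B z} → z < - + B → B ℕ.< ∣ z ∣
below⇒<∣∣ {zero}  -<+         = ℕ.z<s
below⇒<∣∣ {suc B} (-<- B<a)   = ℕ.s<s B<a

private
  cancel-left : ∀ x y → - x + (x + y) ≡ y
  cancel-left = solve-∀

  shifted-negation : ∀ y s → - (y + s) + s ≡ - y
  shifted-negation = solve-∀

beyond : (L : ℕ) (z : ℤ) → ∃ λ k → + L < z + + k
beyond L (+ a)      = suc L , +<+ (ℕ.m≤n+m (suc L) a)
beyond L -[1+ a ]   = suc a ℕ.+ suc L , subst (+ L <_) eq (+<+ (ℕ.n<1+n L))
  where
  eq : + suc L ≡ -[1+ a ] + + (suc a ℕ.+ suc L)
  eq = trans (sym (cancel-left (+ suc a) (+ suc L))) (cong (λ t → -[1+ a ] + t) (sym (ℤ.pos-+ (suc a) (suc L))))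

periodic⇒zero : (N : ℕ) → 1 ℕ.≤ N → (G : ℤ → ℤ) (L : ℕ) → Supported L G → (R : ℤ → Set) →
                    (∀ {z} → R z → R (z + + N)) → (∀ {z} → R z → G (z + + N) ≡ G z) → ∀ z → R z → G z ≡ 0ℤ
periodic⇒zero N 1≤N G L supported R closed periodic z Rz =
  let k , L<z+k = beyond L z in descend k z Rz L<z+k
  where
  descend : ∀ k z → R z → + L < z + + k → G z ≡ 0ℤ
  descend zero    z _  L<z   = supported z (above⇒<∣∣ (subst (+ L <_) (ℤ.+-identityʳ z) L<z))
  descend (suc k) z Rz L<z+k = trans (sym (periodic Rz)) (descend k (z + + N) (closed Rz) (ℤ.<-≤-trans L<z+k advance))
    where
    advance : z + + suc k ≤ (z + + N) + + k
    advance = ℤ.≤-trans (ℤ.+-monoʳ-≤ z (+≤+ (ℕ.+-monoˡ-≤ k 1≤N)))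
                     (ℤ.≤-reflexive (trans (cong (λ t → z + t) (ℤ.pos-+ N k)) (sym (ℤ.+-assoc z (+ N) (+ k)))))

2K<N⇒K<-K+N : ∀ {K N} → K ℕ.+ K ℕ.< N → + K < - + K + + N
2K<N⇒K<-K+N {K} {N} 2K<N = subst (+ K <_) (trans (sym (ℤ.⊖-≥ K≤N)) (sym (ℤ.-m+n≡n⊖m K N))) (+<+ K<N∸K)
  where
  K≤N : K ℕ.≤ N
  K≤N = ℕ.≤-trans (ℕ.m≤m+n K K) (ℕ.<⇒≤ 2K<N)
  K<N∸K : K ℕ.< N ℕ.∸ K
  K<N∸K = subst (ℕ._< N ℕ.∸ K) (ℕ.m+n∸n≡m K K) (ℕ.∸-monoˡ-< 2K<N (ℕ.m≤n+m K K))

-- G (z + N) = G z whenever |z| > K.  Iterating upwards from z > K, or downwards from z ≤ K (then z - jN < -K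
-- for every j ≥ 1 since N > 2K), reaches the region where G vanishes.
difference-supported⇒zero : (N K L : ℕ) → K ℕ.+ K ℕ.< N → (G : ℤ → ℤ) → Supported L G →
                            Supported K (λ z → G (z + + N) - G z) → ∀ z → G z ≡ 0ℤ
difference-supported⇒zero N K L 2K<N G supportedG supportedΔ z = by-side (z ℤ.≤? + K)
  where
  1≤N : 1 ℕ.≤ N
  1≤N = ℕ.≤-trans (ℕ.s≤s ℕ.z≤n) 2K<N
  flat : ∀ {x} → K ℕ.< ∣ x ∣ → G (x + + N) ≡ G x
  flat {x} far = ℤ.i-j≡0⇒i≡j _ _ (supportedΔ x far)
  supported⁻ : Supported L (G ∘ -_)
  supported⁻ y far = supportedG (- y) (subst (L ℕ.<_) (sym (ℤ.∣-i∣≡∣i∣ y)) far)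
  mirrored : ∀ {y} → - + K ≤ y → G (- (y + + N)) ≡ G (- y)
  mirrored {y} -K≤y = trans (sym (flat (below⇒<∣∣ (ℤ.neg-mono-< K<y+N)))) (cong G (shifted-negation y (+ N)))
    where
    K<y+N : + K < y + + N
    K<y+N = ℤ.<-≤-trans (2K<N⇒K<-K+N 2K<N) (ℤ.+-monoˡ-≤ (+ N) -K≤y)
  by-side : Dec (z ≤ + K) → G z ≡ 0ℤ
  by-side (no z≰K)  = periodic⇒zero N 1≤N G L supportedG (+ K <_)
                                    (λ {x} K<x → ℤ.<-≤-trans K<x (ℤ.i≤i+j x (+ N))) (λ K<x → flat (above⇒<∣∣ K<x)) z (ℤ.≰⇒> z≰K)
  by-side (yes z≤K) = trans (cong G (sym (ℤ.neg-involutive z)))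
                            (periodic⇒zero N 1≤N (G ∘ -_) L supported⁻ (- + K ≤_)
                                           (λ {y} -K≤y → ℤ.≤-trans -K≤y (ℤ.i≤i+j y (+ N))) mirrored (- z) (ℤ.neg-mono-≤ z≤K))

-- Commutators with a power of a generator

endpoint-power : (i : Fin n) (N : ℕ) (q : Point n) → endpoint q (power i (+ N)) ≡ translate i (+ N) q
endpoint-power i zero    q = sym (translate-0 i q)
endpoint-power i (suc N) q = trans (endpoint-power i N (translate i 1ℤ q)) (translate-translate i (+ N) 1ℤ q)

axis-power-not-derived : (N : ℕ) → ¬ InDerived (power {suc m} zero (+ suc N))
axis-power-not-derived N derived with trans (sym (endpoint-power zero (suc N) origin)) (derived⇒Loop derived origin)
... | ()

walkFlow-comm-power : (c : Word n) → Loop c → (i : Fin n) (N : ℕ) (e : Edge n) →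
                      walkFlow origin (comm c (power i (+ N))) e ≡ walkFlow origin c (shiftEdge i (+ N) e) - walkFlow origin c e
walkFlow-comm-power c ℓ i N e = begin
  walkFlow origin (comm c v) e                                ≡⟨ walkFlow-comm origin c v e ℓ ⟩
  walkFlow o′ c e - walkFlow origin c e                       ≡⟨ cong (_- walkFlow origin c e) (walkFlow-translate i (+ N) o′ c e) ⟨
  walkFlow (translate i (+ N) o′) c (shiftEdge i (+ N) e) - walkFlow origin c e
      ≡⟨ cong (λ p → walkFlow p c (shiftEdge i (+ N) e) - walkFlow origin c e) back-to-origin ⟩
  walkFlow origin c (shiftEdge i (+ N) e) - walkFlow origin c e ∎
  where
  open ≡-Reasoning
  v = power i (+ N)
  o′ = endpoint origin (inv v)
  back-to-origin : translate i (+ N) o′ ≡ origin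
  back-to-origin = trans (sym (endpoint-power i N o′)) (endpoint-inv′ origin v)

comm-axis-power-trivial : (N : ℕ) (c d : Word (suc m)) → length d ℕ.+ length d ℕ.< N → InDerived c →
                          d ≈ comm c (power zero (+ N)) → d ≈ []
comm-axis-power-trivial N c d 2∣d∣<N c∈G′ d≈[c,v] = flowless⇒trivial d closed flowless
  where
  v = power zero (+ N)
  ℓc = derived⇒Loop c∈G′
  difference : ∀ e → walkFlow origin d e ≡ walkFlow origin c (shiftEdge zero (+ N) e) - walkFlow origin c e
  difference e = trans (walkFlow-cong d≈[c,v] origin e) (walkFlow-comm-power c ℓc zero N e)
  c-flowless : ∀ e → walkFlow origin c e ≡ 0ℤ
  c-flowless ((z ∷ p) , j) =
    difference-supported⇒zero N (length d) (length c) 2∣d∣<N (λ x → walkFlow origin c ((x ∷ p) , j))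
      (λ x → walkFlow-supported origin c (x ∷ p) j)
      (λ x far → trans (sym (difference ((x ∷ p) , j))) (walkFlow-supported origin d (x ∷ p) j far)) z
  flowless : ∀ e → walkFlow origin d e ≡ 0ℤ
  flowless e = trans (difference e) (cong₂ _-_ (c-flowless _) (c-flowless e))
  closed : endpoint origin d ≡ origin
  closed = trans (endpoint-cong d≈[c,v] origin) (Loop-comm c v origin)

lemma14p2 : (n : ℕ) → n ≥ 2 → (d : Word n) → InDerived d
    → ((v : Word n) → ¬ InDerived v → Σ (Word n) (λ c → InDerived c × (d ≈ comm c v)))
    → d ≈ []
lemma14p2 zero    ()      d _ _
lemma14p2 (suc m) _       d _ commutator-with =
  let c , c∈G′ , d≈[c,v] = commutator-with (power zero (+ N)) (axis-power-not-derived (length d ℕ.+ length d))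
  in  comm-axis-power-trivial N c d (ℕ.n<1+n _) c∈G′ d≈[c,v]
  where
  N = suc (length d ℕ.+ length d)
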